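{- Let $n$ be an integer with $2\le n\le 7$ and let $m\ge 0$ be an integer such that $m+1,m+2,\dots,m+n$ are all composite numbers. Then the binomial coefficient $\binom{m+n}{n}$ can be written as $$\binom{m+n}{n}=\prod_{i=1}^{n}a_i,$$ where $a_1,\dots,a_n$ are positive integers such that $a_i\mid (m+i)$ and $a_i>1$ for every $1\le i\le n$, and $\gcd(a_i,a_j)=1$ for all $1\le i\ne j\le n$. -}

module Defs where

open import Data.Nat using (ℕ; suc; _*_)
open import Data.Fin using (Fin; zero; suc)

prodFin : (n : ℕ) → (Fin n → ℕ) → ℕ
prodFin ℕ.zero f = 1
prodFin (suc n) f = f zero * prodFin n (λ i → f (suc i))

{-# OPTIONS --safe #-}
-- Since (m + 1) ⋯ (m + n) = n! · C(m + n, n), it suffices to split n! = ∏ G_t with G_t ∣ m + t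
-- and to take a_t = (m + t) / G_t. The split is made one prime p ≤ 7 at a time: the term of
-- maximal p-adic valuation keeps what the others leave of v_p(n!), every other term gives up its
-- whole p-part, so p divides at most one a_t. A common divisor of a_s and a_t divides t − s ≤ 6,
-- so only 2, 3 and 5 could occur in it, and the a_t are pairwise coprime. These local splittings
-- depend on m only modulo a small multiple of a power of p and are checked by evaluation on all
-- residues. Finally a_t = 1 would give m + t ∣ n! ∣ 5040, and a finite search shows that some
-- m + j is then not composite.
module Submission where

open import Defs
open import Data.Bool using (Bool; true; false; if_then_else_; _∧_; _∨_; not)
open import Data.Nat
  using ( ℕ; zero; suc; _+_; _*_; _∸_; _^_; _≤_; _<_; _<?_; s≤s; z<s; _≡ᵇ_; _<ᵇ_; _%_; _/_; _!
        ; NonZero; ≢-nonZero; ≢-nonZero⁻¹)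
open import Data.Nat.Properties
open import Data.Nat.Divisibility
open import Data.Nat.DivMod using (m≡m%n+[m/n]*n; m%n<n; m/n*n≡m)
open import Data.Nat.Coprimality using (Coprime; coprime?; coprime-divisor; coprime⇒gcd≡1)
import Data.Nat.Coprimality as Coprime
open import Data.Nat.LCM using (lcm; lcm-least; gcd*lcm)
open import Data.Nat.Primality using (Composite; composite?)
open import Data.Nat.Combinatorics using (_C_; _P_; nCk≡nPk/k!; k![n∸k]!∣n!)
open import Data.Nat.Combinatorics.Base using (_P′_)
open import Data.Nat.Combinatorics.Specification using (nP′k≡n!/[n∸k]!; nPk≡n!/[n∸k]!; k!∣nP′k)
open import Data.Fin as Fin using (Fin; toℕ; fromℕ<)
import Data.Fin.Properties as Finₚ
open import Data.Product using (Σ; ∃; _×_; _,_; proj₁; proj₂)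
open import Data.Sum using (_⊎_; inj₁; inj₂)
open import Data.Empty using (⊥; ⊥-elim)
open import Relation.Nullary using (Dec; ¬_; contradiction)
open import Relation.Nullary.Decidable using (True; toWitness; _×-dec_; _→-dec_; ¬?; from-yes)
open import Relation.Binary.Definitions using (Tri; tri<; tri≈; tri>)
open import Relation.Binary.PropositionalEquality
  using (_≡_; _≢_; refl; sym; trans; cong; cong₂; subst; module ≡-Reasoning)

prodFin-cong : ∀ n {f g : Fin n → ℕ} → (∀ i → f i ≡ g i) → prodFin n f ≡ prodFin n g
prodFin-cong zero    f≡g = refl
prodFin-cong (suc n) f≡g = cong₂ _*_ (f≡g Fin.zero) (prodFin-cong n (λ i → f≡g (Fin.suc i)))

prodFin-* : ∀ n (f g : Fin n → ℕ) → prodFin n (λ i → f i * g i) ≡ prodFin n f * prodFin n g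
prodFin-* zero    f g = refl
prodFin-* (suc n) f g = trans
  (cong (f Fin.zero * g Fin.zero *_) (prodFin-* n (λ i → f (Fin.suc i)) (λ i → g (Fin.suc i))))
  ([m*n]*[o*p]≡[m*o]*[n*p] (f Fin.zero) (g Fin.zero) _ _)

∣prodFin : ∀ {n} (f : ℕ → ℕ) {t} → t < n → f t ∣ prodFin n (λ i → f (toℕ i))
∣prodFin {suc n} f {zero}  _         = m∣m*n _
∣prodFin {suc n} f {suc t} (s≤s t<n) = ∣-trans (∣prodFin (λ t → f (suc t)) t<n) (n∣m*n (f 0))

P′≡prodFin : ∀ n m → (m + n) P′ n ≡ prodFin n (λ i → m + suc (toℕ i))
P′≡prodFin zero    m = refl
P′≡prodFin (suc n) m rewrite +-suc m n = cong₂ _*_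
  (trans (m+n∸n≡m (suc m) n) (sym (+-comm m 1)))
  (trans (P′≡prodFin n (suc m)) (prodFin-cong n (λ i → sym (+-suc m (suc (toℕ i))))))

C*!≡prodFin : ∀ n m → ((m + n) C n) * n ! ≡ prodFin n (λ i → m + suc (toℕ i))
C*!≡prodFin n m = begin
  ((m + n) C n) * n !             ≡⟨ cong (_* n !) (nCk≡nPk/k! n≤m+n) ⟩
  (((m + n) P n) / n !) * n !   ≡⟨ cong (λ k → (k / n !) * n !) P≡P′ ⟩
  (((m + n) P′ n) / n !) * n !  ≡⟨ m/n*n≡m (k!∣nP′k n≤m+n) ⟩
  (m + n) P′ n                  ≡⟨ P′≡prodFin n m ⟩
  prodFin n (λ i → m + suc (toℕ i)) ∎
  where
  open ≡-Reasoning
  instance _ = n !≢0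
  instance _ = (m + n ∸ n) !≢0
  n≤m+n : n ≤ m + n
  n≤m+n = m≤n+m n m
  P≡P′ : (m + n) P n ≡ (m + n) P′ n
  P≡P′ = trans (nPk≡n!/[n∸k]! n≤m+n) (sym (nP′k≡n!/[n∸k]! n≤m+n))

C≡prodFin-quotients : ∀ n m (g : Fin n → ℕ) (g∣ : ∀ i → g i ∣ m + suc (toℕ i)) →
  prodFin n g ≡ n ! → (m + n) C n ≡ prodFin n (λ i → quotient (g∣ i))
C≡prodFin-quotients n m g g∣ prodFin-g≡n! = *-cancelʳ-≡ _ _ (n !) {{n !≢0}} (begin
  ((m + n) C n) * n !                      ≡⟨ C*!≡prodFin n m ⟩
  prodFin n (λ i → m + suc (toℕ i))      ≡⟨ prodFin-cong n (λ i → _∣_.equality (g∣ i)) ⟩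
  prodFin n (λ i → quotient (g∣ i) * g i) ≡⟨ prodFin-* n _ g ⟩
  prodFin n (λ i → quotient (g∣ i)) * prodFin n g ≡⟨ cong (prodFin n _ *_) prodFin-g≡n! ⟩
  prodFin n (λ i → quotient (g∣ i)) * n ! ∎)
  where open ≡-Reasoning

coprime-∣ : ∀ {a b A B} → a ∣ A → b ∣ B → Coprime A B → Coprime a b
coprime-∣ a∣A b∣B coprime (d∣a , d∣b) = coprime (∣-trans d∣a a∣A , ∣-trans d∣b b∣B)

coprime-*ʳ : ∀ {m n o} → Coprime m n → Coprime m o → Coprime m (n * o)
coprime-*ʳ m⊥n m⊥o (d∣m , d∣no) =
  m⊥o (d∣m , coprime-divisor (coprime-∣ d∣m ∣-refl m⊥n) d∣no)

coprime-^ʳ : ∀ {m n} k → Coprime m n → Coprime m (n ^ k)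
coprime-^ʳ zero    m⊥n (_ , d∣1) = ∣1⇒≡1 d∣1
coprime-^ʳ (suc k) m⊥n = coprime-*ʳ m⊥n (coprime-^ʳ k m⊥n)

coprime-^ : ∀ {m n} j k → Coprime m n → Coprime (m ^ j) (n ^ k)
coprime-^ j k m⊥n = Coprime.sym (coprime-^ʳ j (Coprime.sym (coprime-^ʳ k m⊥n)))

coprime⇒*∣ : ∀ {a b x} → Coprime a b → a ∣ x → b ∣ x → a * b ∣ x
coprime⇒*∣ {a} {b} a⊥b a∣x b∣x = subst (_∣ _) lcm≡* (lcm-least a∣x b∣x)
  where
  lcm≡* : lcm a b ≡ a * b
  lcm≡* = trans (sym (*-identityˡ (lcm a b)))
    (trans (cong (_* lcm a b) (sym (coprime⇒gcd≡1 a⊥b))) (gcd*lcm a b))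

small-divisor-cases : ∀ {d k} .{{_ : NonZero k}} → d ∣ k → k ≤ 6 →
  d ≡ 1 ⊎ 2 ∣ d ⊎ 3 ∣ d ⊎ 5 ∣ d
small-divisor-cases {zero} {k} d∣k _ = contradiction (0∣⇒≡0 d∣k) (≢-nonZero⁻¹ k)
small-divisor-cases {1} _ _ = inj₁ refl
small-divisor-cases {2} _ _ = inj₂ (inj₁ ∣-refl)
small-divisor-cases {3} _ _ = inj₂ (inj₂ (inj₁ ∣-refl))
small-divisor-cases {4} _ _ = inj₂ (inj₁ (divides 2 refl))
small-divisor-cases {5} _ _ = inj₂ (inj₂ (inj₂ ∣-refl))
small-divisor-cases {6} _ _ = inj₂ (inj₁ (divides 3 refl))
small-divisor-cases {suc (suc (suc (suc (suc (suc (suc d))))))} d∣k k≤6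
  with s≤s (s≤s (s≤s (s≤s (s≤s (s≤s ()))))) ← ≤-trans (∣⇒≤ d∣k) k≤6

∣-gap : ∀ {d} m {i j} → i ≤ j → d ∣ m + i → d ∣ m + j → d ∣ j ∸ i
∣-gap {d} m {i} {j} i≤j d∣m+i d∣m+j = ∣m+n∣m⇒∣n (subst (d ∣_) m+j≡m+i+[j∸i] d∣m+j) d∣m+i
  where
  m+j≡m+i+[j∸i] : m + j ≡ m + i + (j ∸ i)
  m+j≡m+i+[j∸i] = trans (cong (m +_) (sym (m+[n∸m]≡n i≤j))) (sym (+-assoc m i (j ∸ i)))

m+k≡[m/M]*M+[m%M+k] : ∀ m k M .{{_ : NonZero M}} → m + k ≡ (m / M) * M + (m % M + k)
m+k≡[m/M]*M+[m%M+k] m k M = begin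
  m + k                     ≡⟨ cong (_+ k) (m≡m%n+[m/n]*n m M) ⟩
  m % M + (m / M) * M + k   ≡⟨ cong (_+ k) (+-comm (m % M) _) ⟩
  (m / M) * M + m % M + k   ≡⟨ +-assoc ((m / M) * M) (m % M) k ⟩
  (m / M) * M + (m % M + k) ∎
  where open ≡-Reasoning

∣[m%M+k]⇒∣[m+k] : ∀ {q} M .{{_ : NonZero M}} m k → q ∣ M → q ∣ m % M + k → q ∣ m + k
∣[m%M+k]⇒∣[m+k] {q} M m k q∣M q∣r+k = subst (q ∣_) (sym (m+k≡[m/M]*M+[m%M+k] m k M))
  (∣m∣n⇒∣m+n (∣-trans q∣M (n∣m*n (m / M))) q∣r+k)

∣[m+k]⇒∣[m%M+k] : ∀ {q} M .{{_ : NonZero M}} m k → q ∣ M → q ∣ m + k → q ∣ m % M + k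
∣[m+k]⇒∣[m%M+k] {q} M m k q∣M q∣m+k =
  ∣m+n∣m⇒∣n (subst (q ∣_) (m+k≡[m/M]*M+[m%M+k] m k M) q∣m+k) (∣-trans q∣M (n∣m*n (m / M)))

-- factor n m t is the share of p ^ exponent n given to m + 1 + t (indices t start at 0).
record LocalFactor (p N : ℕ) : Set where
  field
    factor         : ℕ → ℕ → ℕ → ℕ
    exponent       : ℕ → ℕ
    factor-∣       : ∀ {n} → n < N → ∀ m {t} → t < n → factor n m t ∣ m + suc t
    prodFin-factor : ∀ {n} → n < N → ∀ m → prodFin n (λ i → factor n m (toℕ i)) ≡ p ^ exponent n

  factor-∣-p^exponent : ∀ {n} → n < N → ∀ m {t} → t < n → factor n m t ∣ p ^ exponent n
  factor-∣-p^exponent n<N m t<n = subst (_ ∣_) (prodFin-factor n<N m) (∣prodFin (factor _ m) t<n)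

-- p divides at most one of the cofactors (m + 1 + t) / factor n m t.
Sharp : ∀ {p N} → LocalFactor p N → Set
Sharp {p} {N} L = ∀ {n} → n < N → ∀ m {t u} → t < u → u < n →
  p * factor n m t ∣ m + suc t → p * factor n m u ∣ m + suc u → ⊥
  where open LocalFactor L

-- Local factors depending on m only through r = m % M, certified on every residue r < M. Since
-- p ^ (k + e n) ∣ M, divisibility by a factor (and, for k = 1, by p times it) is periodic in m.
module Periodic (p N M : ℕ) .{{_ : NonZero M}} (e : ℕ → ℕ) (f : ℕ → ℕ → ℕ → ℕ) where

  PowersDivide : ℕ → Set
  PowersDivide k = ∀ {n} → n < N → p ^ (k + e n) ∣ M

  FactorsDivide : Set
  FactorsDivide = ∀ {n} → n < N → ∀ {r} → r < M → ∀ {t} → t < n → f n r t ∣ r + suc t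

  ProductsArePowers : Set
  ProductsArePowers = ∀ {n} → n < N → ∀ {r} → r < M → prodFin n (λ i → f n r (toℕ i)) ≡ p ^ e n

  FactorsSharp : Set
  FactorsSharp = ∀ {n} → n < N → ∀ {r} → r < M → ∀ {u} → u < n → ∀ {t} → t < u →
    ¬ (p * f n r t ∣ r + suc t × p * f n r u ∣ r + suc u)

  Certificate : ℕ → Set
  Certificate k = PowersDivide k × FactorsDivide × ProductsArePowers

  certificate? : ∀ k → Dec (Certificate k)
  certificate? k =
    allUpTo? (λ n → p ^ (k + e n) ∣? M) N ×-dec
    allUpTo? (λ n → allUpTo? (λ r → allUpTo? (λ t → f n r t ∣? r + suc t) n) M) N ×-dec
    allUpTo? (λ n → allUpTo? (λ r → prodFin n (λ i → f n r (toℕ i)) ≟ p ^ e n) M) N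

  sharpCertificate? : Dec (Certificate 1 × FactorsSharp)
  sharpCertificate? = certificate? 1 ×-dec
    allUpTo? (λ n → allUpTo? (λ r → allUpTo? (λ u → allUpTo? (λ t →
      ¬? ((p * f n r t ∣? r + suc t) ×-dec (p * f n r u ∣? r + suc u))) u) n) M) N

  localFactor : ∀ k → Certificate k → LocalFactor p N
  localFactor k (p^[k+e]∣M , f∣ , prodFin-f) = record
    { factor         = λ n m t → f n (m % M) t
    ; exponent       = e
    ; factor-∣       = λ n<N m t<n →
        ∣[m%M+k]⇒∣[m+k] M m _ (f∣M n<N m t<n) (f∣ n<N (m%n<n m M) t<n)
    ; prodFin-factor = λ n<N m → prodFin-f n<N (m%n<n m M)
    }
    where
    f∣M : ∀ {n} → n < N → ∀ m {t} → t < n → f n (m % M) t ∣ M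
    f∣M {n} n<N m t<n = ∣-trans (subst (_ ∣_) (prodFin-f n<N (m%n<n m M)) (∣prodFin _ t<n))
      (∣-trans (divides (p ^ k) (^-distribˡ-+-* p k (e n))) (p^[k+e]∣M n<N))

  localFactor-sharp : (c : Certificate 1) → FactorsSharp → Sharp (localFactor 1 c)
  localFactor-sharp c sharp n<N m {t} {u} t<u u<n pft∣ pfu∣ =
    sharp n<N (m%n<n m M) u<n t<u (lower (<-trans t<u u<n) pft∣ , lower u<n pfu∣)
    where
    lower : ∀ {s} → s < _ → p * f _ (m % M) s ∣ m + suc s → p * f _ (m % M) s ∣ m % M + suc s
    lower s<n = ∣[m+k]⇒∣[m%M+k] M m _
      (∣-trans (*-monoʳ-∣ p (LocalFactor.factor-∣-p^exponent (localFactor 1 c) n<N m s<n))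
        (proj₁ c n<N))

-- x serves as fuel, and valuation p 0 = 0.
valuation : (p : ℕ) .{{_ : NonZero p}} → ℕ → ℕ
valuation p x = go x x
  where
  go : ℕ → ℕ → ℕ
  go zero    y = 0
  go (suc k) y with y % p
  ... | zero  = suc (go k (y / p))
  ... | suc _ = 0

even : ℕ → Bool
even x = x % 2 ≡ᵇ 0

module ValuationSplit (p : ℕ) .{{_ : NonZero p}} (preferEven : Bool) where

  ν : ℕ → ℕ → ℕ
  ν r t = valuation p (r + suc t)

  improves : ℕ → ℕ → ℕ → Bool
  improves r b t = (ν r b <ᵇ ν r t)
    ∨ preferEven ∧ (ν r b ≡ᵇ ν r t) ∧ even (r + suc t) ∧ not (even (r + suc b))

  pivot : ℕ → ℕ → ℕ
  pivot r zero    = 0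
  pivot r (suc n) = if improves r (pivot r n) n then n else pivot r n

  Σν : ℕ → ℕ → ℕ
  Σν r zero    = 0
  Σν r (suc n) = ν r n + Σν r n

  exponent : ℕ → ℕ
  exponent n = valuation p (n !)

  factor : ℕ → ℕ → ℕ → ℕ
  factor n r t = if t ≡ᵇ pivot r n
    then p ^ (exponent n ∸ (Σν r n ∸ ν r t))
    else p ^ ν r t

module V₂ = ValuationSplit 2 false
module V₃ = ValuationSplit 3 false
-- Breaking ties towards even terms is what excludes a unit cofactor for p = 5 (hence M = 50).
module V₅ = ValuationSplit 5 true
module V₇ = ValuationSplit 7 false

module P₂ = Periodic 2 8 32 V₂.exponent V₂.factor
module P₃ = Periodic 3 8 27 V₃.exponent V₃.factor
module P₅ = Periodic 5 8 50 V₅.exponent V₅.factor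
module P₇ = Periodic 7 8 7  V₇.exponent V₇.factor

certificate₂ : P₂.Certificate 1 × P₂.FactorsSharp
certificate₂ = from-yes P₂.sharpCertificate?

certificate₃ : P₃.Certificate 1 × P₃.FactorsSharp
certificate₃ = from-yes P₃.sharpCertificate?

certificate₅ : P₅.Certificate 1 × P₅.FactorsSharp
certificate₅ = from-yes P₅.sharpCertificate?

certificate₇ : P₇.Certificate 0
certificate₇ = from-yes (P₇.certificate? 0)

local₂ : LocalFactor 2 8
local₂ = P₂.localFactor 1 (proj₁ certificate₂)

local₃ : LocalFactor 3 8
local₃ = P₃.localFactor 1 (proj₁ certificate₃)

local₅ : LocalFactor 5 8
local₅ = P₅.localFactor 1 (proj₁ certificate₅)

local₇ : LocalFactor 7 8
local₇ = P₇.localFactor 0 certificate₇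

sharp₂ : Sharp local₂
sharp₂ = P₂.localFactor-sharp (proj₁ certificate₂) (proj₂ certificate₂)

sharp₃ : Sharp local₃
sharp₃ = P₃.localFactor-sharp (proj₁ certificate₃) (proj₂ certificate₃)

sharp₅ : Sharp local₅
sharp₅ = P₅.localFactor-sharp (proj₁ certificate₅) (proj₂ certificate₅)

g₂ g₃ g₅ g₇ : ℕ → ℕ → ℕ → ℕ
g₂ = LocalFactor.factor local₂
g₃ = LocalFactor.factor local₃
g₅ = LocalFactor.factor local₅
g₇ = LocalFactor.factor local₇

G : ℕ → ℕ → ℕ → ℕ
G n m t = g₂ n m t * (g₃ n m t * (g₅ n m t * g₇ n m t))

g₂∣G : ∀ n m t → g₂ n m t ∣ G n m t
g₂∣G n m t = m∣m*n _

g₃∣G : ∀ n m t → g₃ n m t ∣ G n m t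
g₃∣G n m t = ∣-trans (m∣m*n (g₅ n m t * g₇ n m t)) (n∣m*n (g₂ n m t))

g₅∣G : ∀ n m t → g₅ n m t ∣ G n m t
g₅∣G n m t = ∣-trans (∣-trans (m∣m*n (g₇ n m t)) (n∣m*n (g₃ n m t))) (n∣m*n (g₂ n m t))

prime-power-product : ℕ → ℕ
prime-power-product n = 2 ^ e local₂ * (3 ^ e local₃ * (5 ^ e local₅ * 7 ^ e local₇))
  where
  e : ∀ {p} → LocalFactor p 8 → ℕ
  e L = LocalFactor.exponent L n

prime-power-product≡! : ∀ {n} → n < 8 → prime-power-product n ≡ n !
prime-power-product≡! = from-yes (allUpTo? (λ n → prime-power-product n ≟ n !) 8)

G∣m+1+t : ∀ {n} → n < 8 → ∀ m {t} → t < n → G n m t ∣ m + suc t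
G∣m+1+t {n} n<8 m {t} t<n =
  coprime⇒*∣ 2⊥357 (local-∣ local₂)
    (coprime⇒*∣ 3⊥57 (local-∣ local₃)
      (coprime⇒*∣ 5⊥7 (local-∣ local₅) (local-∣ local₇)))
  where
  e : ∀ {p} → LocalFactor p 8 → ℕ
  e L = LocalFactor.exponent L n
  local-∣ : ∀ {p} (L : LocalFactor p 8) → LocalFactor.factor L n m t ∣ m + suc t
  local-∣ L = LocalFactor.factor-∣ L n<8 m t<n
  bound : ∀ {p} (L : LocalFactor p 8) → LocalFactor.factor L n m t ∣ p ^ e L
  bound L = LocalFactor.factor-∣-p^exponent L n<8 m t<n
  coprime-powers : ∀ {p q} (L : LocalFactor p 8) (K : LocalFactor q 8) → {True (coprime? p q)} →
    Coprime (p ^ e L) (q ^ e K)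
  coprime-powers L K {p⊥q} = coprime-^ (e L) (e K) (toWitness p⊥q)
  5⊥7 : Coprime (g₅ n m t) (g₇ n m t)
  5⊥7 = coprime-∣ (bound local₅) (bound local₇) (coprime-powers local₅ local₇)
  3⊥57 : Coprime (g₃ n m t) (g₅ n m t * g₇ n m t)
  3⊥57 = coprime-∣ (bound local₃) (*-pres-∣ (bound local₅) (bound local₇))
    (coprime-*ʳ (coprime-powers local₃ local₅) (coprime-powers local₃ local₇))
  2⊥357 : Coprime (g₂ n m t) (g₃ n m t * (g₅ n m t * g₇ n m t))
  2⊥357 = coprime-∣ (bound local₂) (*-pres-∣ (bound local₃) (*-pres-∣ (bound local₅) (bound local₇)))
    (coprime-*ʳ (coprime-powers local₂ local₃)
      (coprime-*ʳ (coprime-powers local₂ local₅) (coprime-powers local₂ local₇)))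

prodFin-G : ∀ {n} → n < 8 → ∀ m → prodFin n (λ i → G n m (toℕ i)) ≡ n !
prodFin-G {n} n<8 m = begin
  prodFin n (λ i → G n m (toℕ i))
    ≡⟨ trans (prodFin-* n _ _) (cong (∏ local₂ *_)
         (trans (prodFin-* n _ _) (cong (∏ local₃ *_) (prodFin-* n _ _)))) ⟩
  ∏ local₂ * (∏ local₃ * (∏ local₅ * ∏ local₇))
    ≡⟨ cong₂ _*_ (power local₂)
         (cong₂ _*_ (power local₃) (cong₂ _*_ (power local₅) (power local₇))) ⟩
  prime-power-product n
    ≡⟨ prime-power-product≡! n<8 ⟩
  n ! ∎
  where
  open ≡-Reasoning
  ∏ : ∀ {p} → LocalFactor p 8 → ℕ
  ∏ L = prodFin n (λ i → LocalFactor.factor L n m (toℕ i))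
  power : ∀ {p} (L : LocalFactor p 8) → ∏ L ≡ p ^ LocalFactor.exponent L n
  power L = LocalFactor.prodFin-factor L n<8 m

unit-cofactor⇒prime : ∀ {m} → m < 5040 → ∀ {t} → t < 7 → m + suc t ∣ 5040 →
  ∀ {n} → n < 8 → t < n → G n m t ≡ m + suc t → ∃ λ j → j < n × ¬ Composite (m + suc j)
unit-cofactor⇒prime = from-yes (allUpTo? (λ m → allUpTo? (λ t → (m + suc t ∣? 5040) →-dec
  allUpTo? (λ n → (t <? n) →-dec ((G n m t ≟ m + suc t) →-dec
    anyUpTo? (λ j → ¬? (composite? (m + suc j))) n)) 8) 7) 5040)

G≢m+1+t : ∀ {n} → n < 8 → ∀ m {t} → t < n → (∀ {j} → j < n → Composite (m + suc j)) →
  G n m t ≢ m + suc t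
G≢m+1+t {n} n<8 m {t} t<n composite G≡x =
  refute (unit-cofactor⇒prime m<5040 (<-≤-trans t<n (≤-pred n<8)) x∣5040 n<8 t<n G≡x)
  where
  x∣5040 : m + suc t ∣ 5040
  x∣5040 = subst (_∣ 5040) G≡x
    (∣-trans (subst (G n m t ∣_) (prodFin-G n<8 m) (∣prodFin (G n m) t<n))
      (∣-trans (m∣m*n _) (k![n∸k]!∣n! (≤-pred n<8))))
  m<5040 : m < 5040
  m<5040 = <-≤-trans (m<m+n m z<s) (∣⇒≤ x∣5040)
  refute : ∃ (λ j → j < n × ¬ Composite (m + suc j)) → ⊥
  refute (j , j<n , ¬composite) = ¬composite (composite j<n)

module Cofactors {n} (n<8 : n < 8) (m : ℕ) where

  G∣term : (i : Fin n) → G n m (toℕ i) ∣ m + suc (toℕ i)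
  G∣term i = G∣m+1+t n<8 m (Finₚ.toℕ<n i)

  cofactor : Fin n → ℕ
  cofactor i = quotient (G∣term i)

  C≡prodFin-cofactor : (m + n) C n ≡ prodFin n cofactor
  C≡prodFin-cofactor = C≡prodFin-quotients n m _ G∣term (prodFin-G n<8 m)

  cofactor-∣ : ∀ i → cofactor i ∣ m + suc (toℕ i)
  cofactor-∣ i = quotient-∣ (G∣term i)

  1<cofactor : ((i : Fin n) → Composite (m + suc (toℕ i))) → ∀ i → 1 < cofactor i
  1<cofactor composite i =
    quotient>1 (G∣term i) (≤∧≢⇒< (∣⇒≤ (G∣term i)) (G≢m+1+t n<8 m (Finₚ.toℕ<n i) composite′))
    where
    instance _ = ≢-nonZero (m+1+n≢0 m)
    composite′ : ∀ {j} → j < n → Composite (m + suc j)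
    composite′ j<n =
      subst (λ j → Composite (m + suc j)) (Finₚ.toℕ-fromℕ< j<n) (composite (fromℕ< j<n))

  excess : ∀ {p} (L : LocalFactor p 8) → (∀ t → LocalFactor.factor L n m t ∣ G n m t) →
    ∀ i → p ∣ cofactor i → p * LocalFactor.factor L n m (toℕ i) ∣ m + suc (toℕ i)
  excess {p} L f∣G i p∣a = subst (p * LocalFactor.factor L n m (toℕ i) ∣_)
    (sym (_∣_.equality (G∣term i))) (*-pres-∣ p∣a (f∣G (toℕ i)))

  cofactors-coprime-< : ∀ {i j} → i Fin.< j → Coprime (cofactor i) (cofactor j)
  cofactors-coprime-< {i} {j} i<j {d} (d∣aᵢ , d∣aⱼ) =
    by-cases (small-divisor-cases {{≢-nonZero (m>n⇒m∸n≢0 i<j)}} d∣gap gap≤6)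
    where
    d∣gap : d ∣ toℕ j ∸ toℕ i
    d∣gap = ∣-gap m (s≤s (<⇒≤ i<j)) (∣-trans d∣aᵢ (cofactor-∣ i)) (∣-trans d∣aⱼ (cofactor-∣ j))
    gap≤6 : toℕ j ∸ toℕ i ≤ 6
    gap≤6 = ≤-trans (m∸n≤m (toℕ j) (toℕ i)) (≤-pred (≤-trans (Finₚ.toℕ<n j) (≤-pred n<8)))
    no-common : ∀ {p} (L : LocalFactor p 8) → Sharp L →
      (∀ t → LocalFactor.factor L n m t ∣ G n m t) → ¬ p ∣ d
    no-common L sharp f∣G p∣d = sharp n<8 m i<j (Finₚ.toℕ<n j)
      (excess L f∣G i (∣-trans p∣d d∣aᵢ)) (excess L f∣G j (∣-trans p∣d d∣aⱼ))
    by-cases : d ≡ 1 ⊎ 2 ∣ d ⊎ 3 ∣ d ⊎ 5 ∣ d → d ≡ 1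
    by-cases (inj₁ d≡1)               = d≡1
    by-cases (inj₂ (inj₁ 2∣d))        = ⊥-elim (no-common local₂ sharp₂ (g₂∣G n m) 2∣d)
    by-cases (inj₂ (inj₂ (inj₁ 3∣d))) = ⊥-elim (no-common local₃ sharp₃ (g₃∣G n m) 3∣d)
    by-cases (inj₂ (inj₂ (inj₂ 5∣d))) = ⊥-elim (no-common local₅ sharp₅ (g₅∣G n m) 5∣d)

  cofactors-coprime : ∀ i j → i ≢ j → Coprime (cofactor i) (cofactor j)
  cofactors-coprime i j i≢j = by-trichotomy (Finₚ.<-cmp i j)
    where
    by-trichotomy : Tri (i Fin.< j) (i ≡ j) (j Fin.< i) → Coprime (cofactor i) (cofactor j)
    by-trichotomy (tri< i<j _ _) = cofactors-coprime-< i<j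
    by-trichotomy (tri≈ _ i≡j _) = contradiction i≡j i≢j
    by-trichotomy (tri> _ _ j<i) = Coprime.sym (cofactors-coprime-< j<i)

corollary1 : (n m : ℕ) → 2 ≤ n → n ≤ 7 →
    ((i : Fin n) → Composite (m + suc (toℕ i))) →
    Σ (Fin n → ℕ) (λ a →
      ((m + n) C n ≡ prodFin n a)
      × ((i : Fin n) → a i ∣ m + suc (toℕ i))
      × ((i : Fin n) → 1 < a i)
      × ((i j : Fin n) → i ≢ j → Coprime (a i) (a j)))
corollary1 n m _ n≤7 composite =
  cofactor , C≡prodFin-cofactor , cofactor-∣ , 1<cofactor composite , cofactors-coprime
  where open Cofactors (s≤s n≤7) m
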